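{- For all integers $n,k\ge 0$, the number of bilateral Dyck paths of semilength $n$ with $k$ up-steps at odd height equals the number of bilateral Dyck paths of semilength $n$ with $k$ peaks.
   Context: Paths are lattice paths starting at $(0,0)$ with up-steps $(1,1)$ and down-steps $(1,-1)$. A bilateral Dyck path of semilength $n$ has $n$ up-steps and $n$ down-steps (so it ends on $y=0$; vertices may have negative $y$-coordinate). An up-step from $(i-1,j-1)$ to $(i,j)$ is at height $j$, and it is at odd height if $j$ is odd ($j\in\mathbb{Z}$). A peak is an up-step immediately followed by a down-step. -}

module Defs where

open import Data.Nat using (ℕ; zero; suc; _+_; _*_)
open import Data.Integer as ℤ using (ℤ; +_)
open import Data.Bool using (Bool; true; false)
open import Data.List using (List; []; _∷_; _++_; map; length; filter)
open import Relation.Nullary using (Dec; yes; no)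
open import Relation.Unary using (Decidable)
open import Relation.Binary.PropositionalEquality using (_≡_)
open import Data.Product using (_×_)
import Data.Nat as ℕ
import Data.Nat.Properties as ℕP
open import Relation.Nullary.Decidable using (_×-dec_)

-- Steps of a lattice path: U = (1,1), D = (1,-1).
data Step : Set where
  U D : Step

allWords : ℕ → List (List Step)
allWords zero = [] ∷ []
allWords (suc m) = map (U ∷_) (allWords m) ++ map (D ∷_) (allWords m)

numU : List Step → ℕ
numU [] = 0
numU (U ∷ s) = suc (numU s)
numU (D ∷ s) = numU s

numD : List Step → ℕ
numD [] = 0
numD (U ∷ s) = numD s
numD (D ∷ s) = suc (numD s)

IsBilateralDyck : ℕ → List Step → Set
IsBilateralDyck n s = (numU s ≡ n) × (numD s ≡ n)

isBilateralDyck? : (n : ℕ) → Decidable (IsBilateralDyck n)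
isBilateralDyck? n s = (numU s ℕP.≟ n) ×-dec (numD s ℕP.≟ n)

-- Number of up-steps at odd height, for a path starting at height h.
-- An up-step from height h-1 to h is at height h.
oddUpsFrom : ℤ → List Step → ℕ
oddUpsFrom h [] = 0
oddUpsFrom h (U ∷ s) with ℤ.∣ h ℤ.+ + 1 ∣ ℕ.% 2
... | 1 = suc (oddUpsFrom (h ℤ.+ + 1) s)
... | _ = oddUpsFrom (h ℤ.+ + 1) s
oddUpsFrom h (D ∷ s) = oddUpsFrom (h ℤ.- + 1) s

oddUps : List Step → ℕ
oddUps = oddUpsFrom (+ 0)

peaks : List Step → ℕ
peaks [] = 0
peaks (U ∷ D ∷ s) = suc (peaks (D ∷ s))
peaks (_ ∷ s) = peaks s

pathsOddUps : ℕ → ℕ → List (List Step)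
pathsOddUps n k =
  filter (λ s → (isBilateralDyck? n s) ×-dec (oddUps s ℕP.≟ k)) (allWords (2 * n))

pathsPeaks : ℕ → ℕ → List (List Step)
pathsPeaks n k =
  filter (λ s → (isBilateralDyck? n s) ×-dec (peaks s ℕP.≟ k)) (allWords (2 * n))

-- Both numbers equal C(n,k)².
--
-- The height after i steps has the parity of i, so an up-step is at odd
-- height exactly when it is at an odd position.  Split a word of length 2n
-- into the subwords of its odd and of its even positions, both of length n;
-- the word is determined by the pair, and if a of the odd-position steps and
-- c of the even-position steps are up (so n - c of the latter are down), the
-- word is bilateral Dyck iff a + c = n, i.e. iff a = n - c.  Hence the paths
-- with k up-steps at odd height correspond to pairs of words of length n with
-- k ups in the first and k downs in the second: C(n,k)² of them.
--
-- Words with u ups, d downs and k peaks number C(u,k)·C(d,k); this is proved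
-- by recursion on the first step, keeping track of the step preceding the
-- remaining suffix.
module Submission where

open import Defs
open import Data.Bool using (Bool; true; false; _∧_; if_then_else_)
open import Data.Bool.Properties using (∧-zeroʳ)
open import Data.Integer as ℤ using (+_; -[1+_]; ∣_∣)
open import Data.List using (List; []; _∷_; _++_; map; length; filter)
open import Data.List.Relation.Unary.All as All using (All; []; _∷_)
import Data.List.Relation.Unary.All.Properties as All
open import Data.Nat using (ℕ; zero; suc; _+_; _*_; _∸_; _%_; _≡ᵇ_; _<_; s≤s; z≤n)
open import Data.Nat.Combinatorics using (_C_; nCk+nC[k+1]≡[n+1]C[k+1])
open import Data.Nat.Properties
  using (_≟_; +-comm; +-identityʳ; +-suc; +-cancelˡ-≡; *-zeroʳ; *-distribˡ-+; *-distribʳ-+; suc-injective)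
open import Data.Product using (_×_; _,_)
open import Function using (_∘_; _⇔_; mk⇔)
open import Relation.Nullary.Decidable using (does; does-⇔; _×-dec_)
open import Relation.Unary using (Pred; Decidable)
open import Relation.Binary.PropositionalEquality
open ≡-Reasoning

count : {A : Set} → (A → Bool) → List A → ℕ
count p []       = 0
count p (x ∷ xs) = if p x then suc (count p xs) else count p xs

module _ {A : Set} where

  length-filter≡count : ∀ {ℓ} {P : Pred A ℓ} (P? : Decidable P) xs →
                        length (filter P? xs) ≡ count (does ∘ P?) xs
  length-filter≡count P? []       = refl
  length-filter≡count P? (x ∷ xs) with does (P? x)
  ... | true  = cong suc (length-filter≡count P? xs)
  ... | false = length-filter≡count P? xs

  count-++ : ∀ (p : A → Bool) xs ys → count p (xs ++ ys) ≡ count p xs + count p ys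
  count-++ p []       ys = refl
  count-++ p (x ∷ xs) ys with p x
  ... | true  = cong suc (count-++ p xs ys)
  ... | false = count-++ p xs ys

  count-map : ∀ {B : Set} (p : B → Bool) (f : A → B) xs → count p (map f xs) ≡ count (p ∘ f) xs
  count-map p f []       = refl
  count-map p f (x ∷ xs) with p (f x)
  ... | true  = cong suc (count-map p f xs)
  ... | false = count-map p f xs

  count-none : ∀ {p : A → Bool} xs → (∀ x → p x ≡ false) → count p xs ≡ 0
  count-none []       p≡false = refl
  count-none (x ∷ xs) p≡false rewrite p≡false x = count-none xs p≡false

  count-cong : ∀ {p q : A → Bool} {xs} → All (λ x → p x ≡ q x) xs → count p xs ≡ count q xs
  count-cong []                = refl
  count-cong {q = q} {x ∷ _} (p≡q ∷ ps) rewrite p≡q with q x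
  ... | true  = cong suc (count-cong ps)
  ... | false = count-cong ps

allWords-length : ∀ m → All (λ s → length s ≡ m) (allWords m)
allWords-length zero    = refl ∷ []
allWords-length (suc m) = All.++⁺ (All.map⁺ (All.map (cong suc) (allWords-length m)))
                                  (All.map⁺ (All.map (cong suc) (allWords-length m)))

count-allWords-suc : ∀ (p : List Step → Bool) m →
                     count p (allWords (suc m)) ≡
                     count (p ∘ (U ∷_)) (allWords m) + count (p ∘ (D ∷_)) (allWords m)
count-allWords-suc p m = begin
  count p (map (U ∷_) W ++ map (D ∷_) W)         ≡⟨ count-++ p (map (U ∷_) W) (map (D ∷_) W) ⟩
  count p (map (U ∷_) W) + count p (map (D ∷_) W) ≡⟨ cong₂ _+_ (count-map p (U ∷_) W) (count-map p (D ∷_) W) ⟩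
  count (p ∘ (U ∷_)) W + count (p ∘ (D ∷_)) W     ∎
  where
  W : List (List Step)
  W = allWords m

count-numU≡C : ∀ n i → count (λ s → numU s ≡ᵇ i) (allWords n) ≡ n C i
count-numU≡C zero    zero    = refl
count-numU≡C zero    (suc i) = refl
count-numU≡C (suc n) zero = begin
  count (λ s → numU s ≡ᵇ 0) (allWords (suc n))
    ≡⟨ count-allWords-suc (λ s → numU s ≡ᵇ 0) n ⟩
  count (λ _ → false) (allWords n) + count (λ s → numU s ≡ᵇ 0) (allWords n)
    ≡⟨ cong₂ _+_ (count-none (allWords n) (λ _ → refl)) (count-numU≡C n zero) ⟩
  1 ∎
count-numU≡C (suc n) (suc i) = begin
  count (λ s → numU s ≡ᵇ suc i) (allWords (suc n))
    ≡⟨ count-allWords-suc (λ s → numU s ≡ᵇ suc i) n ⟩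
  count (λ s → numU s ≡ᵇ i) (allWords n) + count (λ s → numU s ≡ᵇ suc i) (allWords n)
    ≡⟨ cong₂ _+_ (count-numU≡C n i) (count-numU≡C n (suc i)) ⟩
  n C i + n C suc i
    ≡⟨ nCk+nC[k+1]≡[n+1]C[k+1] n i ⟩
  suc n C suc i ∎

count-numD≡C : ∀ n j → count (λ s → numD s ≡ᵇ j) (allWords n) ≡ n C j
count-numD≡C zero    zero    = refl
count-numD≡C zero    (suc j) = refl
count-numD≡C (suc n) zero = begin
  count (λ s → numD s ≡ᵇ 0) (allWords (suc n))
    ≡⟨ count-allWords-suc (λ s → numD s ≡ᵇ 0) n ⟩
  count (λ s → numD s ≡ᵇ 0) (allWords n) + count (λ _ → false) (allWords n)
    ≡⟨ cong₂ _+_ (count-numD≡C n zero) (count-none (allWords n) (λ _ → refl)) ⟩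
  1 ∎
count-numD≡C (suc n) (suc j) = begin
  count (λ s → numD s ≡ᵇ suc j) (allWords (suc n))
    ≡⟨ count-allWords-suc (λ s → numD s ≡ᵇ suc j) n ⟩
  count (λ s → numD s ≡ᵇ suc j) (allWords n) + count (λ s → numD s ≡ᵇ j) (allWords n)
    ≡⟨ cong₂ _+_ (count-numD≡C n (suc j)) (count-numD≡C n j) ⟩
  n C suc j + n C j
    ≡⟨ +-comm (n C suc j) (n C j) ⟩
  n C j + n C suc j
    ≡⟨ nCk+nC[k+1]≡[n+1]C[k+1] n j ⟩
  suc n C suc j ∎

-- Odd and even positions

mutual
  oddPositions : List Step → List Step
  oddPositions []      = []
  oddPositions (x ∷ s) = x ∷ evenPositions s

  evenPositions : List Step → List Step
  evenPositions []      = []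
  evenPositions (_ ∷ s) = oddPositions s

numU-positions : ∀ s → numU s ≡ numU (oddPositions s) + numU (evenPositions s)
numU-positions []      = refl
numU-positions (U ∷ s) = cong suc (trans (numU-positions s) (+-comm (numU (oddPositions s)) _))
numU-positions (D ∷ s) = trans (numU-positions s) (+-comm (numU (oddPositions s)) _)

numD-positions : ∀ s → numD s ≡ numD (oddPositions s) + numD (evenPositions s)
numD-positions []      = refl
numD-positions (U ∷ s) = trans (numD-positions s) (+-comm (numD (oddPositions s)) _)
numD-positions (D ∷ s) = cong suc (trans (numD-positions s) (+-comm (numD (oddPositions s)) _))

numU+numD≡length : ∀ s → numU s + numD s ≡ length s
numU+numD≡length []      = refl
numU+numD≡length (U ∷ s) = cong suc (numU+numD≡length s)
numU+numD≡length (D ∷ s) = trans (+-suc (numU s) (numD s)) (cong suc (numU+numD≡length s))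

length-positions : ∀ n s → length s ≡ n + n →
                   length (oddPositions s) ≡ n × length (evenPositions s) ≡ n
length-positions zero    []          _   = refl , refl
length-positions (suc n) (_ ∷ [])    len with () ← trans (suc-injective len) (+-suc n n)
length-positions (suc n) (_ ∷ _ ∷ s) len
  with odd , even ← length-positions n s (suc-injective (trans (suc-injective len) (+-suc n n)))
  = cong suc odd , cong suc even

-- A word of length 2n is the same thing as the pair of its odd- and
-- even-position subwords, each of length n.
count-positions : ∀ n (p q : List Step → Bool) →
                  count (λ s → p (oddPositions s) ∧ q (evenPositions s)) (allWords (n + n)) ≡
                  count p (allWords n) * count q (allWords n)
count-positions zero    p q with p [] | q []
... | true  | true  = refl
... | true  | false = refl
... | false | _     = refl
count-positions (suc n) p q rewrite +-suc n n = begin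
  count pq (allWords (suc (suc (n + n))))
    ≡⟨ count-allWords-suc pq (suc (n + n)) ⟩
  count (pq ∘ (U ∷_)) (allWords (suc (n + n))) + count (pq ∘ (D ∷_)) (allWords (suc (n + n)))
    ≡⟨ cong₂ _+_ (count-allWords-suc (pq ∘ (U ∷_)) (n + n)) (count-allWords-suc (pq ∘ (D ∷_)) (n + n)) ⟩
  (count (pq ∘ (U ∷_) ∘ (U ∷_)) W + count (pq ∘ (U ∷_) ∘ (D ∷_)) W) +
  (count (pq ∘ (D ∷_) ∘ (U ∷_)) W + count (pq ∘ (D ∷_) ∘ (D ∷_)) W)
    ≡⟨ cong₂ _+_ (cong₂ _+_ (count-positions n (p ∘ (U ∷_)) (q ∘ (U ∷_)))
                            (count-positions n (p ∘ (U ∷_)) (q ∘ (D ∷_))))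
                 (cong₂ _+_ (count-positions n (p ∘ (D ∷_)) (q ∘ (U ∷_)))
                            (count-positions n (p ∘ (D ∷_)) (q ∘ (D ∷_)))) ⟩
  (pU * qU + pU * qD) + (pD * qU + pD * qD)
    ≡⟨ cong₂ _+_ (*-distribˡ-+ pU qU qD) (*-distribˡ-+ pD qU qD) ⟨
  pU * (qU + qD) + pD * (qU + qD)
    ≡⟨ *-distribʳ-+ (qU + qD) pU pD ⟨
  (pU + pD) * (qU + qD)
    ≡⟨ cong₂ _*_ (count-allWords-suc p n) (count-allWords-suc q n) ⟨
  count p (allWords (suc n)) * count q (allWords (suc n)) ∎
  where
  pq : List Step → Bool
  pq s = p (oddPositions s) ∧ q (evenPositions s)
  W : List (List Step)
  W = allWords (n + n)
  pU pD qU qD : ℕ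
  pU = count (p ∘ (U ∷_)) (allWords n)
  pD = count (p ∘ (D ∷_)) (allWords n)
  qU = count (q ∘ (U ∷_)) (allWords n)
  qD = count (q ∘ (D ∷_)) (allWords n)

-- Up-steps at odd height

%2-suc : ∀ m → suc m % 2 ≡ 1 ∸ m % 2
%2-suc zero          = refl
%2-suc (suc zero)    = refl
%2-suc (suc (suc m)) = %2-suc m

%2-pred : ∀ m → m % 2 ≡ 1 ∸ suc m % 2
%2-pred zero          = refl
%2-pred (suc zero)    = refl
%2-pred (suc (suc m)) = %2-pred m

∣+1∣%2 : ∀ h → ∣ h ℤ.+ + 1 ∣ % 2 ≡ 1 ∸ ∣ h ∣ % 2
∣+1∣%2 (+ m) rewrite +-comm m 1 = %2-suc m
∣+1∣%2 -[1+ zero ]  = refl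
∣+1∣%2 -[1+ suc m ] = %2-pred (suc m)

∣-1∣%2 : ∀ h → ∣ h ℤ.- + 1 ∣ % 2 ≡ 1 ∸ ∣ h ∣ % 2
∣-1∣%2 (+ zero)  = refl
∣-1∣%2 (+ suc m) = %2-pred m
∣-1∣%2 -[1+ m ] rewrite +-identityʳ m = %2-suc (suc m)

-- The rewrites turn the parity test in the up-step clause of oddUpsFrom into a literal.
mutual
  oddUpsFrom-even : ∀ {h} → ∣ h ∣ % 2 ≡ 0 → ∀ s → oddUpsFrom h s ≡ numU (oddPositions s)
  oddUpsFrom-even     _ []      = refl
  oddUpsFrom-even {h} e (U ∷ s) rewrite ∣+1∣%2 h | e =
    cong suc (oddUpsFrom-odd (trans (∣+1∣%2 h) (cong (1 ∸_) e)) s)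
  oddUpsFrom-even {h} e (D ∷ s) = oddUpsFrom-odd (trans (∣-1∣%2 h) (cong (1 ∸_) e)) s

  oddUpsFrom-odd : ∀ {h} → ∣ h ∣ % 2 ≡ 1 → ∀ s → oddUpsFrom h s ≡ numU (evenPositions s)
  oddUpsFrom-odd     _ []      = refl
  oddUpsFrom-odd {h} o (U ∷ s) rewrite ∣+1∣%2 h | o =
    oddUpsFrom-even (trans (∣+1∣%2 h) (cong (1 ∸_) o)) s
  oddUpsFrom-odd {h} o (D ∷ s) = oddUpsFrom-even (trans (∣-1∣%2 h) (cong (1 ∸_) o)) s

oddUps≡numU-oddPositions : ∀ s → oddUps s ≡ numU (oddPositions s)
oddUps≡numU-oddPositions = oddUpsFrom-even refl

bilateralDyck-oddUps⇔ : ∀ n k s → length s ≡ n + n →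
                        (IsBilateralDyck n s × oddUps s ≡ k) ⇔
                        (numU (oddPositions s) ≡ k × numD (evenPositions s) ≡ k)
bilateralDyck-oddUps⇔ n k s len = mk⇔ to from
  where
  a b c e : ℕ
  a = numU (oddPositions s)
  b = numD (oddPositions s)
  c = numU (evenPositions s)
  e = numD (evenPositions s)

  a+b≡n : a + b ≡ n
  c+e≡n : c + e ≡ n
  a+b≡n with odd , _ ← length-positions n s len = trans (numU+numD≡length (oddPositions s)) odd
  c+e≡n with _ , even ← length-positions n s len = trans (numU+numD≡length (evenPositions s)) even

  to : IsBilateralDyck n s × oddUps s ≡ k → a ≡ k × e ≡ k
  to ((ups≡n , _) , oddUps≡k) = a≡k , trans (sym a≡e) a≡k
    where
    a≡k : a ≡ k
    a≡k = trans (sym (oddUps≡numU-oddPositions s)) oddUps≡k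
    a≡e : a ≡ e
    a≡e = +-cancelˡ-≡ c a e (trans (+-comm c a) (trans (sym (numU-positions s)) (trans ups≡n (sym c+e≡n))))

  from : a ≡ k × e ≡ k → IsBilateralDyck n s × oddUps s ≡ k
  from (a≡k , e≡k) =
    ( trans (numU-positions s) (trans (cong (_+ c) a≡e) (trans (+-comm e c) c+e≡n))
    , trans (numD-positions s) (trans (cong (λ x → b + x) (sym a≡e)) (trans (+-comm b a) a+b≡n)) )
    , trans (oddUps≡numU-oddPositions s) a≡k
    where
    a≡e : a ≡ e
    a≡e = trans a≡k (sym e≡k)

bilateralDyckWithOddUps? : ∀ n k → Decidable (λ s → IsBilateralDyck n s × oddUps s ≡ k)
bilateralDyckWithOddUps? n k s = isBilateralDyck? n s ×-dec (oddUps s ≟ k)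

count-bilateralDyck-oddUps : ∀ n k →
  count (does ∘ bilateralDyckWithOddUps? n k) (allWords (n + n)) ≡ (n C k) * (n C k)
count-bilateralDyck-oddUps n k = begin
  count (does ∘ bilateralDyckWithOddUps? n k) (allWords (n + n))
    ≡⟨ count-cong (All.map (λ {s} → same-verdict s) (allWords-length (n + n))) ⟩
  count (λ s → (numU (oddPositions s) ≡ᵇ k) ∧ (numD (evenPositions s) ≡ᵇ k)) (allWords (n + n))
    ≡⟨ count-positions n (λ s → numU s ≡ᵇ k) (λ s → numD s ≡ᵇ k) ⟩
  count (λ s → numU s ≡ᵇ k) (allWords n) * count (λ s → numD s ≡ᵇ k) (allWords n)
    ≡⟨ cong₂ _*_ (count-numU≡C n k) (count-numD≡C n k) ⟩
  (n C k) * (n C k) ∎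
  where
  same-verdict : ∀ s → length s ≡ n + n →
                 does (bilateralDyckWithOddUps? n k s) ≡
                 does ((numU (oddPositions s) ≟ k) ×-dec (numD (evenPositions s) ≟ k))
  same-verdict s len = does-⇔ (bilateralDyck-oddUps⇔ n k s len)
    (bilateralDyckWithOddUps? n k s) ((numU (oddPositions s) ≟ k) ×-dec (numD (evenPositions s) ≟ k))

-- Peaks

-- predC d k = (d - 1) C (k - 1), with (-1) C (-1) = 1.
predC : ℕ → ℕ → ℕ
predC zero    k       = 0 C k
predC (suc d) zero    = 0
predC (suc d) (suc k) = d C k

peakStat : Step → ℕ → ℕ → ℕ → List Step → Bool
peakStat x u d k s = ((numU s ≡ᵇ u) ∧ (numD s ≡ᵇ d)) ∧ (peaks (x ∷ s) ≡ᵇ k)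

-- If x ∷ s has k peaks, its ups form k nonempty runs and a possibly empty
-- final one (C(numU (x ∷ s), k) choices), and the downs of s form k nonempty
-- runs, preceded by a possibly empty one when x = D.
peakCount : Step → ℕ → ℕ → ℕ → ℕ
peakCount U u d k = (suc u C k) * predC d k
peakCount D u d k = (u C k) * (d C k)

peakCountHeadU : ℕ → ℕ → ℕ → ℕ
peakCountHeadU zero    d k = 0
peakCountHeadU (suc u) d k = peakCount U u d k

peakCountHeadD : Step → ℕ → ℕ → ℕ → ℕ
peakCountHeadD x u zero    k       = 0
peakCountHeadD D u (suc d) k       = peakCount D u d k
peakCountHeadD U u (suc d) zero    = 0
peakCountHeadD U u (suc d) (suc k) = peakCount D u d k

predC-pascal : ∀ d k → predC (suc d) k + d C k ≡ suc d C k
predC-pascal d zero    = refl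
predC-pascal d (suc k) = nCk+nC[k+1]≡[n+1]C[k+1] d k

*-pascal : ∀ u k c → (u C suc k) * c + (u C k) * c ≡ (suc u C suc k) * c
*-pascal u k c = begin
  (u C suc k) * c + (u C k) * c ≡⟨ *-distribʳ-+ c (u C suc k) (u C k) ⟨
  (u C suc k + u C k) * c       ≡⟨ cong (_* c) (+-comm (u C suc k) (u C k)) ⟩
  (u C k + u C suc k) * c       ≡⟨ cong (_* c) (nCk+nC[k+1]≡[n+1]C[k+1] u k) ⟩
  (suc u C suc k) * c           ∎

peakCount-head : ∀ x u d k → 0 < u + d →
                 peakCountHeadU u d k + peakCountHeadD x u d k ≡ peakCount x u d k
peakCount-head x zero    zero    k       ()
peakCount-head D zero    (suc d) zero    _ = refl
peakCount-head D zero    (suc d) (suc k) _ = refl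
peakCount-head D (suc u) zero    k       _ = +-identityʳ _
peakCount-head D (suc u) (suc d) k       _ =
  trans (sym (*-distribˡ-+ (suc u C k) (predC (suc d) k) (d C k)))
        (cong ((suc u C k) *_) (predC-pascal d k))
peakCount-head U zero    (suc d) zero    _ = refl
peakCount-head U zero    (suc d) (suc k) _ = *-pascal 0 k (d C k)
peakCount-head U (suc u) zero    zero    _ = refl
peakCount-head U (suc u) zero    (suc k) _ =
  trans (+-identityʳ _) (trans (*-zeroʳ (suc u C suc k)) (sym (*-zeroʳ (suc (suc u) C suc k))))
peakCount-head U (suc u) (suc d) zero    _ = refl
peakCount-head U (suc u) (suc d) (suc k) _ = *-pascal (suc u) k (d C k)

count-peaks : ∀ x u d k m → u + d ≡ m → count (peakStat x u d k) (allWords m) ≡ peakCount x u d k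
count-peaks U zero zero zero    zero _ = refl
count-peaks U zero zero (suc k) zero _ = sym (*-zeroʳ (1 C suc k))
count-peaks D zero zero zero    zero _ = refl
count-peaks D zero zero (suc k) zero _ = refl
count-peaks x u d k (suc m) u+d≡1+m = begin
  count (peakStat x u d k) (allWords (suc m))
    ≡⟨ count-allWords-suc (peakStat x u d k) m ⟩
  count (peakStat x u d k ∘ (U ∷_)) (allWords m) + count (peakStat x u d k ∘ (D ∷_)) (allWords m)
    ≡⟨ cong₂ _+_ (headU x u d k u+d≡1+m) (headD x u d k u+d≡1+m) ⟩
  peakCountHeadU u d k + peakCountHeadD x u d k
    ≡⟨ peakCount-head x u d k (subst (0 <_) (sym u+d≡1+m) (s≤s z≤n)) ⟩
  peakCount x u d k ∎
  where
  headU : ∀ x u d k → u + d ≡ suc m →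
          count (peakStat x u d k ∘ (U ∷_)) (allWords m) ≡ peakCountHeadU u d k
  headU x zero    d k _ = count-none (allWords m) (λ _ → refl)
  headU U (suc u) d k e = count-peaks U u d k m (suc-injective e)
  headU D (suc u) d k e = count-peaks U u d k m (suc-injective e)

  headD : ∀ x u d k → u + d ≡ suc m →
          count (peakStat x u d k ∘ (D ∷_)) (allWords m) ≡ peakCountHeadD x u d k
  headD x u zero    k       _ =
    count-none (allWords m) (λ s → cong (_∧ (peaks (x ∷ D ∷ s) ≡ᵇ k)) (∧-zeroʳ (numU s ≡ᵇ u)))
  headD D u (suc d) k       e = count-peaks D u d k m (suc-injective (trans (sym (+-suc u d)) e))
  headD U u (suc d) zero    _ = count-none (allWords m) (λ _ → ∧-zeroʳ _)
  headD U u (suc d) (suc k) e = count-peaks D u d k m (suc-injective (trans (sym (+-suc u d)) e))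

n+n≡2*n : ∀ n → n + n ≡ 2 * n
n+n≡2*n n = cong (λ x → n + x) (sym (+-identityʳ n))

corollary2 : (n k : ℕ) → length (pathsOddUps n k) ≡ length (pathsPeaks n k)
corollary2 n k = begin
  length (pathsOddUps n k)
    ≡⟨ length-filter≡count (bilateralDyckWithOddUps? n k) (allWords (2 * n)) ⟩
  count (does ∘ bilateralDyckWithOddUps? n k) (allWords (2 * n))
    ≡⟨ cong (count (does ∘ bilateralDyckWithOddUps? n k) ∘ allWords) (n+n≡2*n n) ⟨
  count (does ∘ bilateralDyckWithOddUps? n k) (allWords (n + n))
    ≡⟨ count-bilateralDyck-oddUps n k ⟩
  (n C k) * (n C k)
    ≡⟨ count-peaks D n n k (2 * n) (n+n≡2*n n) ⟨
  count (peakStat D n n k) (allWords (2 * n))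
    ≡⟨ length-filter≡count (λ s → isBilateralDyck? n s ×-dec (peaks s ≟ k)) (allWords (2 * n)) ⟨
  length (pathsPeaks n k) ∎
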